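{- Let $G=(N,T,P,S,R)$ be a tree-controlled grammar with $R\in\mathrm{RL}_1^P$. Then $L(G)=\{w : w\in T^*\text{ and } S\to w\in P\}$ if $R=\{S\}$, and $L(G)=\emptyset$ otherwise.
   Context: A right-linear grammar is $(N',T',P',S')$ with rules of the form $A\to wB$ or $A\to w$, $A,B\in N'$, $w\in T'^*$. $\mathrm{RL}_1^P$ is the family of regular languages generated by some right-linear grammar with at most one production rule. A tree-controlled grammar is a quintuple $G=(N,T,P,S,R)$ where $(N,T,P,S)$ is a context-free grammar whose rules are all non-erasing (the only exception being that $S\to\lambda$ is allowed if $S$ does not occur on the right-hand side of any rule), and $R$ is a regular language over $N\cup T$. For a derivation tree, the word of level $j$ is the word formed by all nodes of depth $j$ read from left to right (level $0$ is the root $S$). $L(G)$ consists of all $z\in T^*$ having a derivation tree $t$ whose leaves read left to right give $z$ and such that the words of all levels of $t$, except the last one, belong to $R$. -}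

module Defs where

open import Data.Nat using (ℕ; zero; suc; _≤_; _<_; _⊔_)
open import Data.Fin using (Fin)
open import Data.Sum using (_⊎_; inj₁; inj₂)
open import Data.Product using (Σ; _×_; _,_)
open import Data.Maybe using (Maybe; just; nothing)
open import Data.List using (List; []; _∷_; _++_; map; concatMap; length)
open import Data.List.Relation.Unary.All using (All)
open import Data.List.Membership.Propositional using (_∈_)
open import Relation.Binary.PropositionalEquality using (_≡_)
open import Relation.Nullary using (¬_)
open import Function.Bundles using (_⇔_)

-- Right-linear grammars over a terminal alphabet Σ'.
-- Nonterminals are Fin nts (a finite set); a rule (A , w , just B) is
-- A → w B and a rule (A , w , nothing) is A → w.

record RLG (Σ' : Set) : Set where
  field
    nts   : ℕ
    start : Fin nts
    rules : List (Fin nts × List Σ' × Maybe (Fin nts))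

open RLG public

data Gen {Σ' : Set} (g : RLG Σ') : Fin (nts g) → List Σ' → Set where
  gen-end  : ∀ {A u} → (A , u , nothing) ∈ rules g → Gen g A u
  gen-step : ∀ {A B u v} → (A , u , just B) ∈ rules g → Gen g B v → Gen g A (u ++ v)

LangRL : {Σ' : Set} → RLG Σ' → List Σ' → Set
LangRL g w = Gen g (start g) w

InRL1P : {Σ' : Set} → (List Σ' → Set) → Set
InRL1P {Σ'} R = Σ (RLG Σ') λ g → (length (rules g) ≤ 1) × (∀ w → R w ⇔ LangRL g w)

Sym : ℕ → ℕ → Set
Sym n m = Fin n ⊎ Fin m

Rule : ℕ → ℕ → Set
Rule n m = Fin n × List (Sym n m)

record TCG (n m : ℕ) : Set₁ where
  field
    P : List (Rule n m)
    S : Fin n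
    R : List (Sym n m) → Set
    -- non-erasing, except S → λ allowed when S occurs on no right-hand side
    nonErasing : ∀ A → (A , []) ∈ P →
                 (A ≡ S) × (∀ B β → (B , β) ∈ P → ¬ (inj₁ S ∈ β))

open TCG public

-- Derivation trees. (lamNode A) is a node A whose single child is a λ-leaf
-- (used for a rule A → λ); node A ts has the nonempty list of children ts.
data Tree (n m : ℕ) : Set where
  leaf    : Fin m → Tree n m
  lamNode : Fin n → Tree n m
  node    : Fin n → List (Tree n m) → Tree n m

rootSym : ∀ {n m} → Tree n m → Sym n m
rootSym (leaf a)    = inj₂ a
rootSym (lamNode A) = inj₁ A
rootSym (node A _)  = inj₁ A

data Valid {n m : ℕ} (P : List (Rule n m)) : Tree n m → Set where
  v-leaf : ∀ {a} → Valid P (leaf a)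
  v-lam  : ∀ {A} → (A , []) ∈ P → Valid P (lamNode A)
  v-node : ∀ {A ts} → ¬ (ts ≡ []) → (A , map rootSym ts) ∈ P →
           All (Valid P) ts → Valid P (node A ts)

yield : ∀ {n m} → Tree n m → List (Fin m)
yieldList : ∀ {n m} → List (Tree n m) → List (Fin m)
yield (leaf a)    = a ∷ []
yield (lamNode A) = []
yield (node A ts) = yieldList ts
yieldList []       = []
yieldList (t ∷ ts) = yield t ++ yieldList ts

-- depth of the tree = index of its last level
height : ∀ {n m} → Tree n m → ℕ
heightList : ∀ {n m} → List (Tree n m) → ℕ
height (leaf a)    = 0
height (lamNode A) = 1
height (node A ts) = suc (heightList ts)
heightList []       = 0
heightList (t ∷ ts) = height t ⊔ heightList ts

level : ∀ {n m} → ℕ → Tree n m → List (Sym n m)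
level zero    t           = rootSym t ∷ []
level (suc j) (leaf a)    = []
level (suc j) (lamNode A) = []
level (suc j) (node A ts) = concatMap (level j) ts

Lang : ∀ {n m} → TCG n m → List (Fin m) → Set
Lang G z = Σ (Tree _ _) λ t →
  Valid (P G) t × (rootSym t ≡ inj₁ (S G)) × (yield t ≡ z) ×
  (∀ j → j < height t → R G (level j t))

RIsS : ∀ {n m} → TCG n m → Set
RIsS G = ∀ w → R G w ⇔ (w ≡ inj₁ (S G) ∷ [])

-- A right-linear grammar with at most one rule derives at most one word: a
-- derivation can only ever apply that rule, which fixes the word. The root S of a
-- derivation tree always lies on a non-last level, so if L(G) is nonempty then
-- S ∈ R, hence R = {S}. When R = {S} every non-last level is the single symbol S,
-- so the tree is a chain S → S → … → S → w whose bottom step is a rule S → w;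
-- conversely a rule S → w is itself a derivation tree of height one.
module Submission where

open import Defs
open import Data.Nat using (ℕ; zero; suc; _≤_; _<_; s≤s; z≤n; _≟_)
open import Data.Nat.Properties using (n≢0⇒n>0; ⊔-identityʳ; m≤m⊔n)
open import Data.Fin using (Fin)
open import Data.Sum using (inj₁; inj₂)
open import Data.Product using (_×_; _,_)
open import Data.List using (List; []; _∷_; _++_; map; length)
open import Data.List.Properties using (∷-injectiveˡ; ++-identityʳ; map-∘)
open import Data.List.Relation.Unary.All using (All; []; _∷_)
open import Data.List.Relation.Unary.Any using (here)
open import Data.List.Membership.Propositional using (_∈_)
open import Relation.Nullary using (¬_; yes; no)
open import Relation.Binary.PropositionalEquality
  using (_≡_; refl; sym; trans; cong; subst)
open import Function.Bundles using (_⇔_; mk⇔; Equivalence)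

∈-unique-of-length≤1 : ∀ {A : Set} {xs : List A} {x y : A} →
  length xs ≤ 1 → x ∈ xs → y ∈ xs → x ≡ y
∈-unique-of-length≤1 {xs = _ ∷ []}    _        (here p)   (here q) = trans p (sym q)
∈-unique-of-length≤1 {xs = _ ∷ _ ∷ _} (s≤s ()) _          _

Gen-unique : ∀ {Σ' : Set} (g : RLG Σ') → length (rules g) ≤ 1 →
  ∀ {A B u v} → Gen g A u → Gen g B v → u ≡ v
Gen-unique g one (gen-end r) (gen-end r') with ∈-unique-of-length≤1 one r r'
... | refl = refl
Gen-unique g one (gen-end r) (gen-step r' _) with ∈-unique-of-length≤1 one r r'
... | ()
Gen-unique g one (gen-step r _) (gen-end r') with ∈-unique-of-length≤1 one r r'
... | ()
Gen-unique g one (gen-step r d) (gen-step r' d') with ∈-unique-of-length≤1 one r r'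
... | refl = cong (_ ++_) (Gen-unique g one d d')

InRL1P⇒singleton : ∀ {Σ' : Set} {L : List Σ' → Set} {w : List Σ'} →
  InRL1P L → L w → ∀ v → L v ⇔ (v ≡ w)
InRL1P⇒singleton {L = L} {w} (g , one , L⇔g) Lw v = mk⇔ to from
  where
    to : L v → v ≡ w
    to Lv = Gen-unique g one (Equivalence.to (L⇔g v) Lv) (Equivalence.to (L⇔g w) Lw)
    from : v ≡ w → L v
    from refl = Lw

module _ {n m : ℕ} where

  LevelsAre : Fin n → Tree n m → Set
  LevelsAre A t = ∀ j → j < height t → level j t ≡ inj₁ A ∷ []

  rootSyms-of-flat : (ts : List (Tree n m)) → heightList ts ≡ 0 →
    map rootSym ts ≡ map inj₂ (yieldList ts)
  rootSyms-of-flat []                _  = refl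
  rootSyms-of-flat (leaf a ∷ ts)     h₀ = cong (inj₂ a ∷_) (rootSyms-of-flat ts h₀)
  rootSyms-of-flat (lamNode _ ∷ ts) h₀ with subst (1 ≤_) h₀ (m≤m⊔n 1 (heightList ts))
  ... | ()
  rootSyms-of-flat (node _ us ∷ ts) h₀
    with subst (suc (heightList us) ≤_) h₀ (m≤m⊔n (suc (heightList us)) (heightList ts))
  ... | ()

  module _ (P' : List (Rule n m)) (A : Fin n) where

    LevelsAre⇒rule : ∀ {t} → Valid P' t → rootSym t ≡ inj₁ A → LevelsAre A t →
      (A , map inj₂ (yield t)) ∈ P'
    LevelsAre⇒rule-deep : ∀ ts → All (Valid P') ts → 0 < heightList ts →
      LevelsAre A (node A ts) → (A , map inj₂ (yieldList ts)) ∈ P'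

    LevelsAre⇒rule (v-lam r) refl _ = r
    LevelsAre⇒rule (v-node {ts = ts} _ r vs) refl levels with heightList ts ≟ 0
    ... | yes flat = subst (λ β → (A , β) ∈ P') (rootSyms-of-flat ts flat) r
    ... | no deep  = LevelsAre⇒rule-deep ts vs (n≢0⇒n>0 deep) levels

    -- Level 1 is the list of the children's roots, so it has length one.
    LevelsAre⇒rule-deep (t ∷ []) (v ∷ []) deep levels =
      subst (λ w → (A , map inj₂ w) ∈ P') (sym (++-identityʳ (yield t)))
        (LevelsAre⇒rule v (∷-injectiveˡ (levels 1 (s≤s deep))) child-levels)
      where
        child-levels : LevelsAre A t
        child-levels j j<h = trans (sym (++-identityʳ (level j t)))
          (levels (suc j) (s≤s (subst (suc j ≤_) (sym (⊔-identityʳ (height t))) j<h)))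
    LevelsAre⇒rule-deep (_ ∷ _ ∷ _) _ deep levels with levels 1 (s≤s deep)
    ... | ()

  ruleTree : Fin n → List (Fin m) → Tree n m
  ruleTree A []      = lamNode A
  ruleTree A (a ∷ z) = node A (map leaf (a ∷ z))

  yieldList-leaves : (z : List (Fin m)) → yieldList (map (leaf {n}) z) ≡ z
  yieldList-leaves []      = refl
  yieldList-leaves (a ∷ z) = cong (a ∷_) (yieldList-leaves z)

  heightList-leaves : (z : List (Fin m)) → heightList (map (leaf {n}) z) ≡ 0
  heightList-leaves []      = refl
  heightList-leaves (_ ∷ z) = heightList-leaves z

  All-Valid-leaves : (P' : List (Rule n m)) (z : List (Fin m)) → All (Valid P') (map leaf z)
  All-Valid-leaves P' []      = []
  All-Valid-leaves P' (_ ∷ z) = v-leaf ∷ All-Valid-leaves P' z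

  ruleTree-valid : ∀ {P' : List (Rule n m)} {A} z → (A , map inj₂ z) ∈ P' →
    Valid P' (ruleTree A z)
  ruleTree-valid []      r = v-lam r
  ruleTree-valid {P'} {A} (a ∷ z) r =
    v-node (λ ()) (subst (λ β → (A , β) ∈ P') (map-∘ {g = rootSym} {f = leaf} (a ∷ z)) r)
      (All-Valid-leaves P' (a ∷ z))

  yield-ruleTree : ∀ (A : Fin n) z → yield (ruleTree A z) ≡ z
  yield-ruleTree A []      = refl
  yield-ruleTree A (a ∷ z) = cong (a ∷_) (yieldList-leaves z)

  height-ruleTree : ∀ (A : Fin n) (z : List (Fin m)) → height (ruleTree A z) ≡ 1
  height-ruleTree A []      = refl
  height-ruleTree A (_ ∷ z) = cong suc (heightList-leaves z)

  rootSym-ruleTree : ∀ (A : Fin n) (z : List (Fin m)) → rootSym (ruleTree A z) ≡ inj₁ A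
  rootSym-ruleTree A []      = refl
  rootSym-ruleTree A (_ ∷ _) = refl

Lang⇒R-start : ∀ {n m} (G : TCG n m) {z} → Lang G z → R G (inj₁ (S G) ∷ [])
Lang⇒R-start G (lamNode _ , _ , refl , _ , controlled) = controlled 0 (s≤s z≤n)
Lang⇒R-start G (node _ _  , _ , refl , _ , controlled) = controlled 0 (s≤s z≤n)

module _ {n m : ℕ} (G : TCG n m) (R≡S : RIsS G) where

  Lang⇒start-rule : ∀ {z} → Lang G z → (S G , map inj₂ z) ∈ P G
  Lang⇒start-rule (t , valid , root , refl , controlled) =
    LevelsAre⇒rule (P G) (S G) valid root
      (λ j j<h → Equivalence.to (R≡S _) (controlled j j<h))

  start-rule⇒Lang : ∀ z → (S G , map inj₂ z) ∈ P G → Lang G z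
  start-rule⇒Lang z r =
    ruleTree (S G) z , ruleTree-valid z r , rootSym-ruleTree (S G) z ,
    yield-ruleTree (S G) z , controlled
    where
      controlled : ∀ j → j < height (ruleTree (S G) z) → R G (level j (ruleTree (S G) z))
      controlled zero _ =
        subst (λ s → R G (s ∷ [])) (sym (rootSym-ruleTree (S G) z))
          (Equivalence.from (R≡S _) refl)
      controlled (suc j) j<h with subst (suc j <_) (height-ruleTree (S G) z) j<h
      ... | s≤s ()

lemma25 : ∀ {n m} (G : TCG n m) → InRL1P (R G) →
    (RIsS G → ∀ (z : List (Fin m)) → Lang G z ⇔ ((S G , map inj₂ z) ∈ P G))
    × (¬ RIsS G → ∀ (z : List (Fin m)) → ¬ Lang G z)
lemma25 G R∈RL₁ =
  (λ R≡S z → mk⇔ (Lang⇒start-rule G R≡S) (start-rule⇒Lang G R≡S z)) ,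
  (λ R≢S z z∈L → R≢S (InRL1P⇒singleton R∈RL₁ (Lang⇒R-start G z∈L)))
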